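{- Let $k,\ell,r$ be positive integers and let $n\geq G(k,\ell;r)$. Let $s=s(k,\ell;r)$ be the minimum, over all $r$-colorings of the edges of the complete graph on $G(k,\ell;r)$ vertices, of the total number of rainbow copies of $K_k$ and monochromatic copies of $K_\ell$. Then every $r$-coloring of the edges of $K_n$ contains at least $$s\,\frac{\binom{n}{m}}{\binom{G(k,\ell;r)}{m}}$$ rainbow $K_k$ copies and monochromatic $K_\ell$ copies (in total), where $m=\min(k,\ell)$.
   Context: An $r$-coloring of the edges of a graph assigns one of $r$ colors to each edge. A copy of a complete graph (a complete subgraph on a given vertex set) is rainbow if all its edges have pairwise distinct colors, and monochromatic if all its edges have the same color. $G(k,\ell;r)$ is the minimum integer $N$ such that every $r$-coloring of the edges of the complete graph on $N$ vertices admits either a rainbow complete subgraph on $k$ vertices or a monochromatic complete subgraph on $\ell$ vertices. -}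

module Defs where

open import Data.Nat using (ℕ; zero; suc; _+_; _≤_)
open import Data.Fin using (Fin; _<_; _<?_)
open import Data.Fin.Properties using (all?; _≟_)
open import Data.Fin.Subset using (Subset; _∈_; ∣_∣; inside; outside)
open import Data.Fin.Subset.Properties using (_∈?_)
open import Data.Vec using ([]; _∷_)
open import Data.List using (List; []; _∷_; _++_; map; filter; length)
open import Data.Product using (_×_; ∃; _,_)
open import Data.Sum using (_⊎_)
open import Relation.Nullary using (Dec)
open import Relation.Nullary.Decidable using (_×-dec_; _→-dec_)
import Data.Nat as ℕ
open import Relation.Binary.PropositionalEquality using (_≡_)

-- An r-coloring of the edges of the complete graph K_n on vertex set Fin n:
-- a symmetric function assigning a color in Fin r to each pair of vertices
-- (only pairs of distinct vertices are ever used).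
record Coloring (n r : ℕ) : Set where
  field
    col : Fin n → Fin n → Fin r
    sym : ∀ i j → col i j ≡ col j i
open Coloring public

Rainbow : ∀ {n r} → Coloring n r → Subset n → Set
Rainbow {n} c S = ∀ (a b x y : Fin n) → a ∈ S → b ∈ S → x ∈ S → y ∈ S →
  a < b → x < y → col c a b ≡ col c x y → (a ≡ x × b ≡ y)

Monochromatic : ∀ {n r} → Coloring n r → Subset n → Set
Monochromatic {n} c S = ∀ (a b x y : Fin n) → a ∈ S → b ∈ S → x ∈ S → y ∈ S →
  a < b → x < y → col c a b ≡ col c x y

HasRainbow : ∀ {n r} → Coloring n r → ℕ → Set
HasRainbow {n} c k = ∃ λ (S : Subset n) → ∣ S ∣ ≡ k × Rainbow c S

HasMono : ∀ {n r} → Coloring n r → ℕ → Set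
HasMono {n} c ℓ = ∃ λ (S : Subset n) → ∣ S ∣ ≡ ℓ × Monochromatic c S

GRProperty : ℕ → ℕ → ℕ → ℕ → Set
GRProperty k ℓ r N = (c : Coloring N r) → HasRainbow c k ⊎ HasMono c ℓ

IsGR : ℕ → ℕ → ℕ → ℕ → Set
IsGR k ℓ r N = GRProperty k ℓ r N × (∀ M → GRProperty k ℓ r M → N ≤ M)

allSubsets : (n : ℕ) → List (Subset n)
allSubsets zero = [] ∷ []
allSubsets (suc n) = map (inside ∷_) (allSubsets n) ++ map (outside ∷_) (allSubsets n)

rainbow? : ∀ {n r} (c : Coloring n r) (S : Subset n) → Dec (Rainbow c S)
rainbow? c S =
  all? λ a → all? λ b → all? λ x → all? λ y →
    (a ∈? S) →-dec (b ∈? S) →-dec (x ∈? S) →-dec (y ∈? S) →-dec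
    (a <? b) →-dec (x <? y) →-dec (col c a b ≟ col c x y) →-dec
    ((a ≟ x) ×-dec (b ≟ y))

mono? : ∀ {n r} (c : Coloring n r) (S : Subset n) → Dec (Monochromatic c S)
mono? c S =
  all? λ a → all? λ b → all? λ x → all? λ y →
    (a ∈? S) →-dec (b ∈? S) →-dec (x ∈? S) →-dec (y ∈? S) →-dec
    (a <? b) →-dec (x <? y) →-dec (col c a b ≟ col c x y)

numRainbow : ∀ {n r} → Coloring n r → ℕ → ℕ
numRainbow {n} c k =
  length (filter (λ S → (∣ S ∣ ℕ.≟ k) ×-dec rainbow? c S) (allSubsets n))

numMono : ∀ {n r} → Coloring n r → ℕ → ℕ
numMono {n} c ℓ =
  length (filter (λ S → (∣ S ∣ ℕ.≟ ℓ) ×-dec mono? c S) (allSubsets n))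

total : ∀ {n r} → Coloring n r → ℕ → ℕ → ℕ
total c k ℓ = numRainbow c k + numMono c ℓ

IsMinTotal : ℕ → ℕ → ℕ → ℕ → ℕ → Set
IsMinTotal k ℓ r G s =
  (∀ (c : Coloring G r) → s ≤ total c k ℓ) × (∃ λ (c : Coloring G r) → total c k ℓ ≡ s)

-- Deleting a vertex v of an r-colored K_(n+1) leaves a colored K_n, and a rainbow K_k
-- (monochromatic K_ℓ) of the big coloring survives in exactly the n+1-k (n+1-ℓ) deletions
-- of vertices outside it. Summing the bound for K_n over all n+1 deletions therefore gives
-- (n+1-m) total(c) C(G,m) ≥ (n+1) s C(n,m) = (n+1-m) s C(n+1,m), the binomial identity being
-- the same double count applied to all m-subsets. Induction from n = G, where the bound is
-- the minimality of s, proves the claim whenever m ≤ G; if m > G then no K_k or K_ℓ fits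
-- into K_G, so s = 0.
module Submission where

open import Defs hiding (sym)
open import Data.Nat using (ℕ; zero; suc; _+_; _*_; _∸_; _≤_; _<_; _⊓_; _≤?_; z≤n; s≤s; >-nonZero)
import Data.Nat as ℕ
open import Data.Nat.Properties hiding (≤∧≢⇒<)
open import Data.Nat.Combinatorics using (_C_; nCk+nC[k+1]≡[n+1]C[k+1])
open import Data.Nat.ListAction using (sum)
open import Data.Nat.ListAction.Properties using (sum-++)
open import Data.Bool using (true; false; if_then_else_)
open import Data.Fin using (Fin; zero; suc; punchIn; punchOut; toℕ)
import Data.Fin as Fin
open import Data.Fin.Properties using (punchIn-injective; punchIn-mono-≤; punchIn-cancel-≤; punchIn-punchOut; ≤∧≢⇒<)
open import Data.Fin.Subset using (Subset; Side; _∈_; ∣_∣; ∁; inside; outside)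
open import Data.Fin.Subset.Properties using (∣p∣≤n; ∣∁p∣≡n∸∣p∣)
open import Data.Vec using ([]; _∷_; lookup; insertAt)
open import Data.Vec.Properties using ([]=⇒lookup; lookup⇒[]=; insertAt-punchIn; insertAt-lookup)
open import Data.List using (List; []; _∷_; _++_; map; filter; length)
open import Data.List.Properties using (map-++; map-∘; filter-none)
import Data.List.Relation.Unary.All as All
open import Data.Product using (∃; _,_; proj₁)
open import Data.Product.Function.NonDependent.Propositional using (_×-⇔_)
open import Data.Sum using (inj₁; inj₂)
open import Function using (_∘_; _⇔_; mk⇔; Equivalence)
open import Level using (Level)
open import Relation.Nullary using (Dec; yes; no; does; contradiction)
open import Relation.Nullary.Decidable using (_×-dec_)
open import Relation.Unary using (Pred; Decidable)
open import Relation.Binary.PropositionalEquality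
open import Algebra.Properties.CommutativeMonoid.Sum +-0-commutativeMonoid using (sum-syntax; sum-cong-≗; ∑-distrib-+)
open import Algebra.Properties.Semiring.Sum +-*-semiring using (*-distribʳ-sum)
open import Algebra.Properties.CommutativeSemigroup *-commutativeSemigroup using (x∙yz≈y∙xz)

private
  variable
    p q : Level
    n : ℕ

∑-const : ∀ n x → ∑[ i < n ] x ≡ n * x
∑-const zero    x = refl
∑-const (suc n) x = cong (x +_) (∑-const n x)

∑-mono-≤ : ∀ {n} {f g : Fin n → ℕ} → (∀ i → f i ≤ g i) → ∑[ i < n ] f i ≤ ∑[ i < n ] g i
∑-mono-≤ {zero}  f≤g = z≤n
∑-mono-≤ {suc n} f≤g = +-mono-≤ (f≤g zero) (∑-mono-≤ (f≤g ∘ suc))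

∑ˢ : ∀ n → (Subset n → ℕ) → ℕ
∑ˢ zero    f = f []
∑ˢ (suc n) f = ∑ˢ n (f ∘ (inside ∷_)) + ∑ˢ n (f ∘ (outside ∷_))

sum-map-allSubsets : ∀ n (f : Subset n → ℕ) → sum (map f (allSubsets n)) ≡ ∑ˢ n f
sum-map-allSubsets zero    f = +-identityʳ (f [])
sum-map-allSubsets (suc n) f = begin
  sum (map f (map (inside ∷_) Ss ++ map (outside ∷_) Ss))
    ≡⟨ cong sum (map-++ f (map (inside ∷_) Ss) _) ⟩
  sum (map f (map (inside ∷_) Ss) ++ map f (map (outside ∷_) Ss))
    ≡⟨ sum-++ (map f (map (inside ∷_) Ss)) _ ⟩
  sum (map f (map (inside ∷_) Ss)) + sum (map f (map (outside ∷_) Ss))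
    ≡⟨ cong₂ _+_ (sum-map-∘ inside) (sum-map-∘ outside) ⟩
  ∑ˢ (suc n) f ∎
  where
  open ≡-Reasoning
  Ss = allSubsets n
  sum-map-∘ : ∀ x → sum (map f (map (x ∷_) Ss)) ≡ ∑ˢ n (f ∘ (x ∷_))
  sum-map-∘ x = trans (cong sum (sym (map-∘ Ss))) (sum-map-allSubsets n (f ∘ (x ∷_)))

∑ˢ-cong : ∀ n {f g : Subset n → ℕ} → f ≗ g → ∑ˢ n f ≡ ∑ˢ n g
∑ˢ-cong zero    f≗g = f≗g []
∑ˢ-cong (suc n) f≗g = cong₂ _+_ (∑ˢ-cong n (f≗g ∘ (inside ∷_))) (∑ˢ-cong n (f≗g ∘ (outside ∷_)))

∑ˢ-zero : ∀ n → ∑ˢ n (λ _ → 0) ≡ 0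
∑ˢ-zero zero    = refl
∑ˢ-zero (suc n) = cong₂ _+_ (∑ˢ-zero n) (∑ˢ-zero n)

*-distribˡ-∑ˢ : ∀ n x (f : Subset n → ℕ) → x * ∑ˢ n f ≡ ∑ˢ n (λ S → x * f S)
*-distribˡ-∑ˢ zero    x f = refl
*-distribˡ-∑ˢ (suc n) x f =
  trans (*-distribˡ-+ x _ _) (cong₂ _+_ (*-distribˡ-∑ˢ n x _) (*-distribˡ-∑ˢ n x _))

∑ˢ-∑-comm : ∀ n m (h : Fin m → Subset n → ℕ) →
  ∑ˢ n (λ S → ∑[ v < m ] h v S) ≡ ∑[ v < m ] ∑ˢ n (h v)
∑ˢ-∑-comm zero    m h = refl
∑ˢ-∑-comm (suc n) m h =
  trans (cong₂ _+_ (∑ˢ-∑-comm n m _) (∑ˢ-∑-comm n m _))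
        (sym (∑-distrib-+ {m} (λ v → ∑ˢ n (h v ∘ (inside ∷_))) (λ v → ∑ˢ n (h v ∘ (outside ∷_)))))

indicator : ∀ {a} {A : Set a} → Dec A → ℕ
indicator d = if does d then 1 else 0

indicator-cong : ∀ {a b} {A : Set a} {B : Set b} → A ⇔ B → (A? : Dec A) (B? : Dec B) →
  indicator A? ≡ indicator B?
indicator-cong A⇔B (yes a) (yes b) = refl
indicator-cong A⇔B (yes a) (no ¬b) = contradiction (Equivalence.to A⇔B a) ¬b
indicator-cong A⇔B (no ¬a) (yes b) = contradiction (Equivalence.from A⇔B b) ¬a
indicator-cong A⇔B (no ¬a) (no ¬b) = refl

length-filter≡sum-indicator : ∀ {a} {A : Set a} {P : Pred A p} (P? : Decidable P) (xs : List A) →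
  length (filter P? xs) ≡ sum (map (indicator ∘ P?) xs)
length-filter≡sum-indicator P? []       = refl
length-filter≡sum-indicator P? (x ∷ xs) with does (P? x)
... | true  = cong suc (length-filter≡sum-indicator P? xs)
... | false = length-filter≡sum-indicator P? xs

countSubsets : {P : Pred (Subset n) p} → Decidable P → ℕ
countSubsets {n} P? = length (filter P? (allSubsets n))

countSubsets≡∑ˢ : {P : Pred (Subset n) p} (P? : Decidable P) →
  countSubsets P? ≡ ∑ˢ n (indicator ∘ P?)
countSubsets≡∑ˢ {n} P? =
  trans (length-filter≡sum-indicator P? (allSubsets n)) (sum-map-allSubsets n _)

countSubsets-size≡nCk : ∀ n k → countSubsets (λ (S : Subset n) → ∣ S ∣ ℕ.≟ k) ≡ n C k
countSubsets-size≡nCk n k = trans (countSubsets≡∑ˢ (λ (S : Subset n) → ∣ S ∣ ℕ.≟ k)) (∑ˢ-size≡nCk n k)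
  where
  ∑ˢ-size≡nCk : ∀ n k → ∑ˢ n (λ S → indicator (∣ S ∣ ℕ.≟ k)) ≡ n C k
  ∑ˢ-size≡nCk zero    zero    = refl
  ∑ˢ-size≡nCk zero    (suc k) = refl
  ∑ˢ-size≡nCk (suc n) zero    = cong₂ _+_ (∑ˢ-zero n) (∑ˢ-size≡nCk n zero)
  ∑ˢ-size≡nCk (suc n) (suc k) =
    trans (cong₂ _+_ (∑ˢ-size≡nCk n k) (∑ˢ-size≡nCk n (suc k))) (nCk+nC[k+1]≡[n+1]C[k+1] n k)

punchInˢ : Fin (suc n) → Subset n → Subset (suc n)
punchInˢ v S = insertAt S v outside

∣punchInˢ∣ : ∀ (v : Fin (suc n)) S → ∣ punchInˢ v S ∣ ≡ ∣ S ∣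
∣punchInˢ∣ zero    S            = refl
∣punchInˢ∣ (suc v) (inside ∷ S)  = cong suc (∣punchInˢ∣ v S)
∣punchInˢ∣ (suc v) (outside ∷ S) = ∣punchInˢ∣ v S

∣punchInˢ∣≡⇔ : ∀ {k} (v : Fin (suc n)) S → (∣ S ∣ ≡ k) ⇔ (∣ punchInˢ v S ∣ ≡ k)
∣punchInˢ∣≡⇔ v S = mk⇔ (trans (∣punchInˢ∣ v S)) (trans (sym (∣punchInˢ∣ v S)))

isOutside : Side → ℕ
isOutside inside  = 0
isOutside outside = 1

∑-isOutside≡∣∁∣ : (T : Subset n) → ∑[ v < n ] isOutside (lookup T v) ≡ ∣ ∁ T ∣
∑-isOutside≡∣∁∣ []            = refl
∑-isOutside≡∣∁∣ (inside  ∷ T) = ∑-isOutside≡∣∁∣ T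
∑-isOutside≡∣∁∣ (outside ∷ T) = cong suc (∑-isOutside≡∣∁∣ T)

∑ˢ-punchInˢ : ∀ n (v : Fin (suc n)) (g : Subset (suc n) → ℕ) →
  ∑ˢ n (g ∘ punchInˢ v) ≡ ∑ˢ (suc n) (λ T → isOutside (lookup T v) * g T)
∑ˢ-punchInˢ n       zero    g =
  sym (cong₂ _+_ (∑ˢ-zero n) (∑ˢ-cong n (λ S → +-identityʳ (g (outside ∷ S)))))
∑ˢ-punchInˢ (suc n) (suc v) g =
  cong₂ _+_ (∑ˢ-punchInˢ n v (g ∘ (inside ∷_))) (∑ˢ-punchInˢ n v (g ∘ (outside ∷_)))

module _ {k} {P : Fin (suc n) → Pred (Subset n) p} {Q : Pred (Subset (suc n)) q}
         (P? : ∀ v → Decidable (P v)) (Q? : Decidable Q)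
         (P⇔Q : ∀ v S → P v S ⇔ Q (punchInˢ v S)) (∣Q∣≡k : ∀ {T} → Q T → ∣ T ∣ ≡ k) where

  ∑-countSubsets-punchInˢ : ∑[ v < suc n ] countSubsets (P? v) ≡ (suc n ∸ k) * countSubsets Q?
  ∑-countSubsets-punchInˢ = begin
    ∑[ v < suc n ] countSubsets (P? v)
      ≡⟨ sum-cong-≗ (λ v → trans (countSubsets≡∑ˢ (P? v)) (∑ˢ-cong n (λ S →
           indicator-cong (P⇔Q v S) (P? v S) (Q? (punchInˢ v S))))) ⟩
    ∑[ v < suc n ] ∑ˢ n (𝟙Q ∘ punchInˢ v)
      ≡⟨ sum-cong-≗ (λ v → ∑ˢ-punchInˢ n v 𝟙Q) ⟩
    ∑[ v < suc n ] ∑ˢ (suc n) (λ T → isOutside (lookup T v) * 𝟙Q T)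
      ≡⟨ ∑ˢ-∑-comm (suc n) (suc n) (λ v T → isOutside (lookup T v) * 𝟙Q T) ⟨
    ∑ˢ (suc n) (λ T → ∑[ v < suc n ] (isOutside (lookup T v) * 𝟙Q T))
      ≡⟨ ∑ˢ-cong (suc n) (λ T → trans (sym (*-distribʳ-sum (𝟙Q T) (isOutside ∘ lookup T)))
                                       (cong (_* 𝟙Q T) (∑-isOutside≡∣∁∣ T))) ⟩
    ∑ˢ (suc n) (λ T → ∣ ∁ T ∣ * 𝟙Q T)
      ≡⟨ ∑ˢ-cong (suc n) (λ T → ∣∁∣-weight T (Q? T)) ⟩
    ∑ˢ (suc n) (λ T → (suc n ∸ k) * 𝟙Q T)
      ≡⟨ trans (cong ((suc n ∸ k) *_) (countSubsets≡∑ˢ Q?)) (*-distribˡ-∑ˢ (suc n) (suc n ∸ k) 𝟙Q) ⟨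
    (suc n ∸ k) * countSubsets Q? ∎
    where
    open ≡-Reasoning
    𝟙Q : Subset (suc n) → ℕ
    𝟙Q = indicator ∘ Q?
    ∣∁∣-weight : ∀ T (Q?T : Dec (Q T)) → ∣ ∁ T ∣ * indicator Q?T ≡ (suc n ∸ k) * indicator Q?T
    ∣∁∣-weight T (yes QT) = cong (_* 1) (trans (∣∁p∣≡n∸∣p∣ T) (cong (suc n ∸_) (∣Q∣≡k QT)))
    ∣∁∣-weight T (no _)   = trans (*-zeroʳ ∣ ∁ T ∣) (sym (*-zeroʳ (suc n ∸ k)))

[n+1∸k]*[n+1]Ck≡[n+1]*nCk : ∀ n k → (suc n ∸ k) * (suc n C k) ≡ suc n * (n C k)
[n+1∸k]*[n+1]Ck≡[n+1]*nCk n k = begin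
  (suc n ∸ k) * (suc n C k)                ≡⟨ cong ((suc n ∸ k) *_) (countSubsets-size≡nCk (suc n) k) ⟨
  (suc n ∸ k) * countSubsets (size≟ (suc n)) ≡⟨ ∑-countSubsets-punchInˢ (λ _ → size≟ n) (size≟ (suc n))
                                                ∣punchInˢ∣≡⇔ (λ ∣T∣≡k → ∣T∣≡k) ⟨
  ∑[ v < suc n ] countSubsets (size≟ n)     ≡⟨ ∑-const (suc n) _ ⟩
  suc n * countSubsets (size≟ n)            ≡⟨ cong (suc n *_) (countSubsets-size≡nCk n k) ⟩
  suc n * (n C k)                           ∎
  where
  open ≡-Reasoning
  size≟ : ∀ n → Decidable (λ (S : Subset n) → ∣ S ∣ ≡ k)
  size≟ n S = ∣ S ∣ ℕ.≟ k

punchIn-mono-< : ∀ (v : Fin (suc n)) {a b} → a Fin.< b → punchIn v a Fin.< punchIn v b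
punchIn-mono-< v {a} {b} a<b =
  ≤∧≢⇒< (punchIn-mono-≤ v a b (<⇒≤ a<b)) (<⇒≢ a<b ∘ cong toℕ ∘ punchIn-injective v a b)

punchIn-cancel-< : ∀ (v : Fin (suc n)) {a b} → punchIn v a Fin.< punchIn v b → a Fin.< b
punchIn-cancel-< v {a} {b} a<b =
  ≤∧≢⇒< (punchIn-cancel-≤ v a b (<⇒≤ a<b)) (<⇒≢ a<b ∘ cong (toℕ ∘ punchIn v))

module _ (v : Fin (suc n)) (S : Subset n) where

  ∈-punchInˢ⁺ : ∀ {a} → a ∈ S → punchIn v a ∈ punchInˢ v S
  ∈-punchInˢ⁺ {a} a∈S = lookup⇒[]= (punchIn v a) (punchInˢ v S)
    (trans (insertAt-punchIn S v outside a) ([]=⇒lookup a∈S))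

  ∈-punchInˢ⁻ : ∀ {a} → punchIn v a ∈ punchInˢ v S → a ∈ S
  ∈-punchInˢ⁻ {a} a∈S =
    lookup⇒[]= a S (trans (sym (insertAt-punchIn S v outside a)) ([]=⇒lookup a∈S))

  ∈-punchInˢ⇒punchIn : ∀ {b} → b ∈ punchInˢ v S → ∃ λ a → punchIn v a ≡ b
  ∈-punchInˢ⇒punchIn {b} b∈S = punchOut v≢b , punchIn-punchOut v≢b
    where
    v≢b : v ≢ b
    v≢b refl with trans (sym (insertAt-lookup S v outside)) ([]=⇒lookup b∈S)
    ... | ()

removeVertex : ∀ {r} → Coloring (suc n) r → Fin (suc n) → Coloring n r
removeVertex c v = record
  { col = λ i j → col c (punchIn v i) (punchIn v j)
  ; sym = λ i j → Coloring.sym c (punchIn v i) (punchIn v j)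
  }

module _ {r} (c : Coloring (suc n) r) (v : Fin (suc n)) (S : Subset n) where

  rainbow-removeVertex⇔ : Rainbow (removeVertex c v) S ⇔ Rainbow c (punchInˢ v S)
  rainbow-removeVertex⇔ = mk⇔ to from
    where
    to : Rainbow (removeVertex c v) S → Rainbow c (punchInˢ v S)
    to R a b x y a∈ b∈ x∈ y∈ a<b x<y ≡col
      with ∈-punchInˢ⇒punchIn v S a∈ | ∈-punchInˢ⇒punchIn v S b∈
         | ∈-punchInˢ⇒punchIn v S x∈ | ∈-punchInˢ⇒punchIn v S y∈
    ... | a′ , refl | b′ , refl | x′ , refl | y′ , refl
      with refl , refl ← R a′ b′ x′ y′
                           (∈-punchInˢ⁻ v S a∈) (∈-punchInˢ⁻ v S b∈) (∈-punchInˢ⁻ v S x∈) (∈-punchInˢ⁻ v S y∈)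
                           (punchIn-cancel-< v a<b) (punchIn-cancel-< v x<y) ≡col
         = refl , refl
    from : Rainbow c (punchInˢ v S) → Rainbow (removeVertex c v) S
    from R a b x y a∈ b∈ x∈ y∈ a<b x<y ≡col
      with a≡x , b≡y ← R _ _ _ _
                         (∈-punchInˢ⁺ v S a∈) (∈-punchInˢ⁺ v S b∈) (∈-punchInˢ⁺ v S x∈) (∈-punchInˢ⁺ v S y∈)
                         (punchIn-mono-< v a<b) (punchIn-mono-< v x<y) ≡col
         = punchIn-injective v a x a≡x , punchIn-injective v b y b≡y

  monochromatic-removeVertex⇔ : Monochromatic (removeVertex c v) S ⇔ Monochromatic c (punchInˢ v S)
  monochromatic-removeVertex⇔ = mk⇔ to from
    where
    to : Monochromatic (removeVertex c v) S → Monochromatic c (punchInˢ v S)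
    to M a b x y a∈ b∈ x∈ y∈ a<b x<y
      with ∈-punchInˢ⇒punchIn v S a∈ | ∈-punchInˢ⇒punchIn v S b∈
         | ∈-punchInˢ⇒punchIn v S x∈ | ∈-punchInˢ⇒punchIn v S y∈
    ... | a′ , refl | b′ , refl | x′ , refl | y′ , refl =
      M a′ b′ x′ y′ (∈-punchInˢ⁻ v S a∈) (∈-punchInˢ⁻ v S b∈) (∈-punchInˢ⁻ v S x∈) (∈-punchInˢ⁻ v S y∈)
                    (punchIn-cancel-< v a<b) (punchIn-cancel-< v x<y)
    from : Monochromatic c (punchInˢ v S) → Monochromatic (removeVertex c v) S
    from M a b x y a∈ b∈ x∈ y∈ a<b x<y =
      M _ _ _ _ (∈-punchInˢ⁺ v S a∈) (∈-punchInˢ⁺ v S b∈) (∈-punchInˢ⁺ v S x∈) (∈-punchInˢ⁺ v S y∈)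
                (punchIn-mono-< v a<b) (punchIn-mono-< v x<y)

module _ {r} (c : Coloring (suc n) r) where

  ∑-numRainbow-removeVertex : ∀ k →
    ∑[ v < suc n ] numRainbow (removeVertex c v) k ≡ (suc n ∸ k) * numRainbow c k
  ∑-numRainbow-removeVertex k = ∑-countSubsets-punchInˢ
    (λ v S → (∣ S ∣ ℕ.≟ k) ×-dec rainbow? (removeVertex c v) S)
    (λ T → (∣ T ∣ ℕ.≟ k) ×-dec rainbow? c T)
    (λ v S → ∣punchInˢ∣≡⇔ v S ×-⇔ rainbow-removeVertex⇔ c v S) proj₁

  ∑-numMono-removeVertex : ∀ ℓ →
    ∑[ v < suc n ] numMono (removeVertex c v) ℓ ≡ (suc n ∸ ℓ) * numMono c ℓ
  ∑-numMono-removeVertex ℓ = ∑-countSubsets-punchInˢ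
    (λ v S → (∣ S ∣ ℕ.≟ ℓ) ×-dec mono? (removeVertex c v) S)
    (λ T → (∣ T ∣ ℕ.≟ ℓ) ×-dec mono? c T)
    (λ v S → ∣punchInˢ∣≡⇔ v S ×-⇔ monochromatic-removeVertex⇔ c v S) proj₁

  ∑-total-removeVertex≤ : ∀ k ℓ →
    ∑[ v < suc n ] total (removeVertex c v) k ℓ ≤ (suc n ∸ k ⊓ ℓ) * total c k ℓ
  ∑-total-removeVertex≤ k ℓ = begin
    ∑[ v < suc n ] total (removeVertex c v) k ℓ
      ≡⟨ ∑-distrib-+ (λ v → numRainbow (removeVertex c v) k) (λ v → numMono (removeVertex c v) ℓ) ⟩
    ∑[ v < suc n ] numRainbow (removeVertex c v) k + ∑[ v < suc n ] numMono (removeVertex c v) ℓ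
      ≡⟨ cong₂ _+_ (∑-numRainbow-removeVertex k) (∑-numMono-removeVertex ℓ) ⟩
    (suc n ∸ k) * numRainbow c k + (suc n ∸ ℓ) * numMono c ℓ
      ≤⟨ +-mono-≤ (*-monoˡ-≤ (numRainbow c k) (∸-monoʳ-≤ (suc n) (m⊓n≤m k ℓ)))
                  (*-monoˡ-≤ (numMono c ℓ) (∸-monoʳ-≤ (suc n) (m⊓n≤n k ℓ))) ⟩
    (suc n ∸ k ⊓ ℓ) * numRainbow c k + (suc n ∸ k ⊓ ℓ) * numMono c ℓ
      ≡⟨ *-distribˡ-+ (suc n ∸ k ⊓ ℓ) (numRainbow c k) (numMono c ℓ) ⟨
    (suc n ∸ k ⊓ ℓ) * total c k ℓ ∎
    where open ≤-Reasoning

countSubsets-size>n≡0 : ∀ {k} {P : Pred (Subset n) p} (P? : Decidable P) → n < k →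
  countSubsets (λ S → (∣ S ∣ ℕ.≟ k) ×-dec P? S) ≡ 0
countSubsets-size>n≡0 {n = n} {k = k} P? n<k =
  cong length (filter-none (λ S → (∣ S ∣ ℕ.≟ k) ×-dec P? S) {allSubsets n}
    (All.tabulate λ {S} _ (∣S∣≡k , _) → <⇒≱ n<k (subst (_≤ n) ∣S∣≡k (∣p∣≤n S))))

total≡0 : ∀ {r k ℓ} (c : Coloring n r) → n < k ⊓ ℓ → total c k ℓ ≡ 0
total≡0 {k = k} {ℓ} c n<m = cong₂ _+_
  (countSubsets-size>n≡0 (rainbow? c) (<-≤-trans n<m (m⊓n≤m k ℓ)))
  (countSubsets-size>n≡0 (mono? c) (<-≤-trans n<m (m⊓n≤n k ℓ)))

averaging-bound : ∀ {n r k ℓ} s X → k ⊓ ℓ ≤ n → (c : Coloring (suc n) r) →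
  (∀ v → s * (n C k ⊓ ℓ) ≤ total (removeVertex c v) k ℓ * X) →
  s * (suc n C k ⊓ ℓ) ≤ total c k ℓ * X
averaging-bound {n} {k = k} {ℓ} s X m≤n c bound =
  *-cancelˡ-≤ (suc n ∸ m) {{>-nonZero (m<n⇒0<n∸m (s≤s m≤n))}} (begin
    (suc n ∸ m) * (s * (suc n C m))                   ≡⟨ x∙yz≈y∙xz (suc n ∸ m) s _ ⟩
    s * ((suc n ∸ m) * (suc n C m))                   ≡⟨ cong (s *_) ([n+1∸k]*[n+1]Ck≡[n+1]*nCk n m) ⟩
    s * (suc n * (n C m))                             ≡⟨ x∙yz≈y∙xz s (suc n) _ ⟩
    suc n * (s * (n C m))                             ≡⟨ ∑-const (suc n) _ ⟨
    ∑[ v < suc n ] (s * (n C m))                      ≤⟨ ∑-mono-≤ bound ⟩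
    ∑[ v < suc n ] (total (removeVertex c v) k ℓ * X) ≡⟨ *-distribʳ-sum X (λ v → total (removeVertex c v) k ℓ) ⟨
    (∑[ v < suc n ] total (removeVertex c v) k ℓ) * X ≤⟨ *-monoˡ-≤ X (∑-total-removeVertex≤ c k ℓ) ⟩
    (suc n ∸ m) * total c k ℓ * X                     ≡⟨ *-assoc (suc n ∸ m) _ X ⟩
    (suc n ∸ m) * (total c k ℓ * X)                   ∎)
  where
  open ≤-Reasoning
  m = k ⊓ ℓ

module _ {k ℓ r G s} (s≤total : ∀ (c : Coloring G r) → s ≤ total c k ℓ) (m≤G : k ⊓ ℓ ≤ G) where

  min-total-scaled : ∀ n → G ≤ n → (c : Coloring n r) → s * (n C k ⊓ ℓ) ≤ total c k ℓ * (G C k ⊓ ℓ)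
  min-total-scaled n G≤n c with m≤n⇒m<n∨m≡n G≤n
  ... | inj₂ refl = *-monoˡ-≤ (G C k ⊓ ℓ) (s≤total c)
  min-total-scaled (suc n) _ c | inj₁ (s≤s G≤n) =
    averaging-bound s (G C k ⊓ ℓ) (≤-trans m≤G G≤n) c
                    (λ v → min-total-scaled n G≤n (removeVertex c v))

lemma4p1 : ∀ (k ℓ r : ℕ) → 1 ≤ k → 1 ≤ ℓ → 1 ≤ r →
    ∀ (G : ℕ) → IsGR k ℓ r G →
    ∀ (s : ℕ) → IsMinTotal k ℓ r G s →
    ∀ (n : ℕ) → G ≤ n → (c : Coloring n r) →
    s * (n C (k ⊓ ℓ)) ≤ total c k ℓ * (G C (k ⊓ ℓ))
lemma4p1 k ℓ r _ _ _ G _ s (s≤total , c₀ , total-c₀≡s) n G≤n c with k ⊓ ℓ ≤? G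
... | yes m≤G = min-total-scaled s≤total m≤G n G≤n c
... | no  m≰G = subst (λ s → s * (n C (k ⊓ ℓ)) ≤ total c k ℓ * (G C (k ⊓ ℓ)))
                      (trans (sym (total≡0 c₀ (≰⇒> m≰G))) total-c₀≡s) z≤n
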